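{- Let $R$ be a set of rewrite rules and let $\mathrm{CC}$ be a computability closure. If, for every rule $f\vec l\to r\in R$ (with $f:T_1\Rightarrow\dots\Rightarrow T_n\Rightarrow B$, $B\in\mathcal{B}$, and $\vec l:\vec T$), $r\in\mathrm{CC}^f(\vec l)$, then every function symbol is computable.
   Context: Simple types over a set $\mathcal{B}$ of base types: $T::=B\mid T\Rightarrow U$; every type is $T_1\Rightarrow\dots\Rightarrow T_n\Rightarrow B$ with $B\in\mathcal{B}$. Disjoint sets $\mathcal{X}$ (variables, infinitely many of each type) and $\mathcal{F}$ (function symbols), each $a$ with type $\tau_a$. Simply typed $\lambda$-terms built from $a\in\mathcal{X}\cup\mathcal{F}$, abstraction $\lambda x t$ and application $vt$, up to $\alpha$-conversion; $\mathrm{FV}(t)$ free variables; $f\vec t=f t_1\dots t_n$. $\to_\beta$ is $\beta$-reduction. A rewrite rule is a pair $l\to r$ with $l=f\vec l$, $f\in\mathcal{F}$, $\mathrm{FV}(r)\subseteq\mathrm{FV}(l)$, $l$ and $r$ of the same type; $\to_R$ is the closure under substitution and context of $R$; $\to\,=\,\to_\beta\cup\to_R$; $\mathrm{SN}^T$ is the set of terms of type $T$ strongly normalizing for $\to$. Computability: $[\![B]\!]=\mathrm{SN}^B$, $[\![T\Rightarrow U]\!]=\{v\in\mathrm{SN}^{T\Rightarrow U}\mid\forall t\in[\![T]\!],vt\in[\![U]\!]\}$; $t:T$ is computable iff $t\in[\![T]\!]$; a symbol is computable iff it is computable as a term; a substitution $\theta$ is computable on a set $X$ of variables if $x\theta$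 is computable for every $x\in X$. A computability closure is a function $\mathrm{CC}$ mapping every symbol $f:T_1\Rightarrow\dots\Rightarrow T_n\Rightarrow B$ and every sequence of terms $\vec l=l_1,\dots,l_n$ with $l_i:T_i$ to a set of terms $\mathrm{CC}^f(\vec l)$, such that for all such $f,\vec l$, all $r\in\mathrm{CC}^f(\vec l)$ and all substitutions $\theta$: $r\theta$ is computable whenever the terms $\vec l\theta$ are computable and $\theta$ is computable on $\mathcal{X}\setminus\mathrm{FV}(\vec l)$. -}

module Defs where

open import Level using (Level)
open import Data.Nat using (ℕ; _≤_)
open import Data.List using (List; []; _∷_)
open import Data.Product using (Σ; ∃; _×_; _,_)
open import Relation.Binary.PropositionalEquality using (_≡_)
open import Relation.Nullary using (¬_)
open import Induction.WellFounded using (Acc)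

infixr 7 _⇒_

data Ty (Base : Set) : Set where
  base : Base → Ty Base
  _⇒_  : Ty Base → Ty Base → Ty Base

target : ∀ {Base} → Ty Base → Base
target (base b) = b
target (T ⇒ U)  = target U

-- A signature: base types 𝓑, function symbols 𝓕 with their types,
-- variables 𝓧 (named by ℕ, disjoint from 𝓕) with their types,
-- infinitely many variables of each type.

record Signature : Set₁ where
  field
    Base    : Set
    Fun     : Set
    typeOf  : Fun → Ty Base
    varTy   : ℕ → Ty Base
    infVars : ∀ (T : Ty Base) (n : ℕ) → ∃ λ m → n ≤ m × varTy m ≡ T

module Syntax (S : Signature) where
  open Signature S public

  Type : Set
  Type = Ty Base

  Ctx : Set
  Ctx = List Type

  -- de Bruijn indices for variables bound by λ (terms are taken up to α)
  data _∋_ : Ctx → Type → Set where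
    here  : ∀ {Γ T}   → (T ∷ Γ) ∋ T
    there : ∀ {Γ T U} → Γ ∋ T → (U ∷ Γ) ∋ T

  -- simply typed λ-terms; `var x` is the (free) variable x ∈ 𝓧,
  -- `bvar` a λ-bound occurrence, `sym f` a function symbol.
  -- A term in the sense of the paper is an element of Tm [] T.
  data Tm (Γ : Ctx) : Type → Set where
    var  : (x : ℕ) → Tm Γ (varTy x)
    bvar : ∀ {T} → Γ ∋ T → Tm Γ T
    sym  : (f : Fun) → Tm Γ (typeOf f)
    lam  : ∀ {T U} → Tm (T ∷ Γ) U → Tm Γ (T ⇒ U)
    app  : ∀ {T U} → Tm Γ (T ⇒ U) → Tm Γ T → Tm Γ U

  Term : Type → Set
  Term = Tm []

  Ren : Ctx → Ctx → Set
  Ren Γ Δ = ∀ {T} → Γ ∋ T → Δ ∋ T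

  extR : ∀ {Γ Δ U} → Ren Γ Δ → Ren (U ∷ Γ) (U ∷ Δ)
  extR ρ here      = here
  extR ρ (there i) = there (ρ i)

  rename : ∀ {Γ Δ T} → Ren Γ Δ → Tm Γ T → Tm Δ T
  rename ρ (var x)   = var x
  rename ρ (bvar i)  = bvar (ρ i)
  rename ρ (sym f)   = sym f
  rename ρ (lam t)   = lam (rename (extR ρ) t)
  rename ρ (app t u) = app (rename ρ t) (rename ρ u)

  weaken : ∀ {Γ U T} → Tm Γ T → Tm (U ∷ Γ) T
  weaken = rename there

  FSub : Ctx → Set
  FSub Γ = (x : ℕ) → Tm Γ (varTy x)

  BSub : Ctx → Ctx → Set
  BSub Γ Δ = ∀ {T} → Γ ∋ T → Tm Δ T

  extB : ∀ {Γ Δ U} → BSub Γ Δ → BSub (U ∷ Γ) (U ∷ Δ)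
  extB σ here      = bvar here
  extB σ (there i) = weaken (σ i)

  subst : ∀ {Γ Δ T} → FSub Δ → BSub Γ Δ → Tm Γ T → Tm Δ T
  subst θ σ (var x)   = θ x
  subst θ σ (bvar i)  = σ i
  subst θ σ (sym f)   = sym f
  subst θ σ (lam t)   = lam (subst (λ x → weaken (θ x)) (extB σ) t)
  subst θ σ (app t u) = app (subst θ σ t) (subst θ σ u)

  noBound : ∀ {Γ} → BSub [] Γ
  noBound ()

  _[_] : ∀ {Γ T} → Term T → FSub Γ → Tm Γ T
  t [ θ ] = subst θ noBound t

  _[_]₀ : ∀ {Γ T U} → Tm (U ∷ Γ) T → Tm Γ U → Tm Γ T
  _[_]₀ {Γ} {T} {U} t u = subst var σ t
    where
      σ : BSub (U ∷ Γ) Γ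
      σ here      = u
      σ (there i) = bvar i

  data _∈FV_ (x : ℕ) : ∀ {Γ T} → Tm Γ T → Set where
    fv-var  : ∀ {Γ} → x ∈FV (var {Γ} x)
    fv-lam  : ∀ {Γ T U} {t : Tm (T ∷ Γ) U} → x ∈FV t → x ∈FV lam t
    fv-appl : ∀ {Γ T U} {t : Tm Γ (T ⇒ U)} {u : Tm Γ T} → x ∈FV t → x ∈FV app t u
    fv-appr : ∀ {Γ T U} {t : Tm Γ (T ⇒ U)} {u : Tm Γ T} → x ∈FV u → x ∈FV app t u

  infixr 5 _∷_
  data Args : Type → Set where
    []  : ∀ {b} → Args (base b)
    _∷_ : ∀ {T U} → Term T → Args U → Args (T ⇒ U)

  app* : ∀ {T} → Term T → Args T → Term (base (target T))
  app* h []       = h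
  app* h (l ∷ ls) = app* (app h l) ls

  _[_]* : ∀ {T} → Args T → FSub [] → Args T
  [] [ θ ]*       = []
  (l ∷ ls) [ θ ]* = (l [ θ ]) ∷ (ls [ θ ]*)

  data _∈FV*_ (x : ℕ) : ∀ {T} → Args T → Set where
    here  : ∀ {T U} {l : Term T} {ls : Args U} → x ∈FV l → x ∈FV* (l ∷ ls)
    there : ∀ {T U} {l : Term T} {ls : Args U} → x ∈FV* ls → x ∈FV* (l ∷ ls)

  record Rule : Set where
    constructor _⟶_
    field
      {ty} : Type
      lhs  : Term ty
      rhs  : Term ty

  data HeadSymbol : ∀ {Γ T} → Tm Γ T → Set where
    head-sym : ∀ {Γ} (f : Fun) → HeadSymbol (sym {Γ} f)
    head-app : ∀ {Γ T U} {t : Tm Γ (T ⇒ U)} {u : Tm Γ T} → HeadSymbol t → HeadSymbol (app t u)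

  IsRewriteRule : Rule → Set
  IsRewriteRule (l ⟶ r) = HeadSymbol l × (∀ x → x ∈FV r → x ∈FV l)

  IsRewriteSystem : (Rule → Set) → Set
  IsRewriteSystem R = ∀ ρ → R ρ → IsRewriteRule ρ

  module Rewriting (R : Rule → Set) where

    data _↦_ {Γ} : ∀ {T} → Tm Γ T → Tm Γ T → Set where
      beta  : ∀ {T U} (t : Tm (T ∷ Γ) U) (u : Tm Γ T) → app (lam t) u ↦ (t [ u ]₀)
      rew   : ∀ {T} {l r : Term T} → R (l ⟶ r) → (θ : FSub Γ) → (l [ θ ]) ↦ (r [ θ ])
      ξ-lam : ∀ {T U} {t t' : Tm (T ∷ Γ) U} → t ↦ t' → lam t ↦ lam t'
      ξ-appl : ∀ {T U} {t t' : Tm Γ (T ⇒ U)} {u : Tm Γ T} → t ↦ t' → app t u ↦ app t' u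
      ξ-appr : ∀ {T U} {t : Tm Γ (T ⇒ U)} {u u' : Tm Γ T} → u ↦ u' → app t u ↦ app t u'

    SN : ∀ {T} → Term T → Set
    SN {T} = Acc (λ (u v : Term T) → v ↦ u)

    ⟦_⟧ : (T : Type) → Term T → Set
    ⟦ base b ⟧ t = SN t
    ⟦ T ⇒ U ⟧ v  = SN v × (∀ (t : Term T) → ⟦ T ⟧ t → ⟦ U ⟧ (app v t))

    Computable : ∀ {T} → Term T → Set
    Computable {T} t = ⟦ T ⟧ t

    ComputableSymbol : Fun → Set
    ComputableSymbol f = Computable (sym f)

    data AllComputable : ∀ {T} → Args T → Set where
      []  : ∀ {b} → AllComputable ([] {b})
      _∷_ : ∀ {T U} {l : Term T} {ls : Args U} → Computable l → AllComputable ls → AllComputable (l ∷ ls)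

    ComputableOutside : ∀ {T} → FSub [] → Args T → Set
    ComputableOutside θ ls = ∀ x → ¬ (x ∈FV* ls) → Computable (θ x)

  Closure : Set₁
  Closure = (f : Fun) → Args (typeOf f) → (T : Type) → Term T → Set

  module _ (R : Rule → Set) where
    open Rewriting R

    IsComputabilityClosure : Closure → Set
    IsComputabilityClosure CC =
      ∀ (f : Fun) (ls : Args (typeOf f)) (T : Type) (r : Term T) → CC f ls T r →
      ∀ (θ : FSub []) → AllComputable (ls [ θ ]*) → ComputableOutside θ ls →
      Computable (r [ θ ])

  data RuleInClosure (CC : Closure) : Rule → Set where
    inCC : ∀ (f : Fun) (ls : Args (typeOf f)) (r : Term (base (target (typeOf f)))) →
           CC f ls _ r → RuleInClosure CC (app* (sym f) ls ⟶ r)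

-- Call a term a spine if it is a variable or a symbol applied to computable arguments.
-- Spines are strongly normalising as soon as every rewrite step at their root leads to
-- a computable term, and then they are computable. Variable-headed spines never
-- rewrite at the root, since left-hand sides are headed by symbols; hence variables
-- are computable. For a symbol-headed spine f l⃗θ = (f l⃗ → r)θ the arguments l⃗θ are
-- computable, and replacing θ by the identity outside FV(l⃗) makes it computable on
-- 𝓧 ∖ FV(l⃗) without changing rθ, so rθ is computable by the closure property.
module Submission where

open import Defs
open import Data.Nat using (_≟_)
open import Data.Bool using (Bool; true; false)
open import Data.Product using (_×_; _,_; proj₁; proj₂)
open import Data.Sum using (_⊎_; inj₁; inj₂; [_,_])
open import Data.Empty using (⊥-elim)
open import Data.List using ([]; _∷_)
open import Relation.Nullary using (¬_; Dec; yes; no)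
open import Relation.Nullary.Decidable using (map′; _⊎-dec_)
open import Relation.Binary.PropositionalEquality
  using (_≡_; refl; cong; cong₂) renaming (subst to transport; sym to ≡-sym)
open import Induction.WellFounded using (acc)

module _ {S : Signature} where
  open Syntax S

  _∈FV?_ : ∀ x {Γ T} (t : Tm Γ T) → Dec (x ∈FV t)
  x ∈FV? var y   = map′ (λ { refl → fv-var }) (λ { fv-var → refl }) (x ≟ y)
  x ∈FV? bvar i  = no λ ()
  x ∈FV? sym f   = no λ ()
  x ∈FV? lam t   = map′ fv-lam (λ { (fv-lam p) → p }) (x ∈FV? t)
  x ∈FV? app t u = map′ [ fv-appl , fv-appr ] (λ { (fv-appl p) → inj₁ p ; (fv-appr p) → inj₂ p })
                        (x ∈FV? t ⊎-dec x ∈FV? u)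

  _∈FV*?_ : ∀ x {T} (ls : Args T) → Dec (x ∈FV* ls)
  x ∈FV*? []       = no λ ()
  x ∈FV*? (l ∷ ls) = map′ [ here , there ] (λ { (here p) → inj₁ p ; (there p) → inj₂ p })
                          (x ∈FV? l ⊎-dec x ∈FV*? ls)

  subst-cong : ∀ {Γ Δ T} {θ θ′ : FSub Δ} (σ : BSub Γ Δ) (t : Tm Γ T) →
               (∀ x → x ∈FV t → θ x ≡ θ′ x) → subst θ σ t ≡ subst θ′ σ t
  subst-cong σ (var x)   eq = eq x fv-var
  subst-cong σ (bvar i)  eq = refl
  subst-cong σ (sym f)   eq = refl
  subst-cong σ (lam t)   eq = cong lam (subst-cong (extB σ) t λ x p → cong weaken (eq x (fv-lam p)))
  subst-cong σ (app t u) eq = cong₂ app (subst-cong σ t λ x p → eq x (fv-appl p))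
                                        (subst-cong σ u λ x p → eq x (fv-appr p))

  []*-cong : ∀ {T} {θ θ′ : FSub []} (ls : Args T) →
             (∀ x → x ∈FV* ls → θ x ≡ θ′ x) → ls [ θ ]* ≡ ls [ θ′ ]*
  []*-cong []       eq = refl
  []*-cong (l ∷ ls) eq = cong₂ _∷_ (subst-cong noBound l λ x p → eq x (here p))
                                   ([]*-cong ls λ x p → eq x (there p))

  app*-[] : ∀ {T} (h : Term T) (ls : Args T) (θ : FSub []) →
            app* h ls [ θ ] ≡ app* (h [ θ ]) (ls [ θ ]*)
  app*-[] h []       θ = refl
  app*-[] h (l ∷ ls) θ = app*-[] (app h l) ls θ

  ∈FV-app* : ∀ {x T} (h : Term T) (ls : Args T) → x ∈FV app* h ls → x ∈FV h ⊎ x ∈FV* ls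
  ∈FV-app* h []       p = inj₁ p
  ∈FV-app* h (l ∷ ls) p with ∈FV-app* (app h l) ls p
  ... | inj₁ (fv-appl q) = inj₁ q
  ... | inj₁ (fv-appr q) = inj₂ (here q)
  ... | inj₂ q           = inj₂ (there q)

  HeadSymbol-subst : ∀ {Γ Δ T} (θ : FSub Δ) (σ : BSub Γ Δ) {t : Tm Γ T} →
                     HeadSymbol t → HeadSymbol (subst θ σ t)
  HeadSymbol-subst θ σ (head-sym f) = head-sym f
  HeadSymbol-subst θ σ (head-app h) = head-app (HeadSymbol-subst θ σ h)

  restrict : ∀ {T} → FSub [] → Args T → FSub []
  restrict θ ls x with x ∈FV*? ls
  ... | yes _ = θ x
  ... | no  _ = var x

  restrict-inside : ∀ {T} (θ : FSub []) (ls : Args T) x → x ∈FV* ls → restrict θ ls x ≡ θ x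
  restrict-inside θ ls x p with x ∈FV*? ls
  ... | yes _ = refl
  ... | no ¬p = ⊥-elim (¬p p)

  restrict-outside : ∀ {T} (θ : FSub []) (ls : Args T) x → ¬ x ∈FV* ls → restrict θ ls x ≡ var x
  restrict-outside θ ls x ¬p with x ∈FV*? ls
  ... | yes p = ⊥-elim (¬p p)
  ... | no _  = refl

  data Head : Bool → ∀ {T} → Term T → Set where
    var : ∀ {withSymbols} x → Head withSymbols (var x)
    sym : ∀ f → Head true (sym f)

  module _ (R : Rule → Set) where
    open Rewriting R

    computable⇒SN : ∀ {T} {t : Term T} → Computable t → SN t
    computable⇒SN {base b} c = c
    computable⇒SN {T ⇒ U}  c = proj₁ c

    computable-↦ : ∀ {T} {t t′ : Term T} → Computable t → t ↦ t′ → Computable t′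
    computable-↦ {base b} (acc rs)     st = rs st
    computable-↦ {T ⇒ U}  (acc rs , c) st = rs st , λ u cu → computable-↦ (c u cu) (ξ-appl st)

    data Spine (withSymbols : Bool) : ∀ {T} → Term T → Set where
      head : ∀ {T} {h : Term T} → Head withSymbols h → Spine withSymbols h
      app  : ∀ {T U} {t : Term (T ⇒ U)} {u : Term T} →
             Spine withSymbols t → Computable u → Spine withSymbols (app t u)

    Spine-app* : ∀ {withSymbols T} {h : Term T} (ls : Args T) →
                 Spine withSymbols (app* h ls) → Spine withSymbols h × AllComputable ls
    Spine-app* []       s = s , []
    Spine-app* (l ∷ ls) s with Spine-app* ls s
    ... | app s′ cl , cls = s′ , cl ∷ cls

    Spine-¬lam : ∀ {withSymbols T U} {t : Tm (T ∷ []) U} → ¬ Spine withSymbols (lam t)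
    Spine-¬lam (head ())

    Spine-¬HeadSymbol : ∀ {T} {t : Term T} → Spine false t → ¬ HeadSymbol t
    Spine-¬HeadSymbol (head (var x)) ()
    Spine-¬HeadSymbol (app s cu)     (head-app h) = Spine-¬HeadSymbol s h

    -- The constructor rew has index l [ θ ], which is not a pattern; every proof
    -- of SN below therefore abstracts the source of the step behind an equation.
    module SpineComputability
      (withSymbols : Bool)
      (rules-at-base : ∀ {T U} {l r : Term (T ⇒ U)} → ¬ R (l ⟶ r))
      (root-step : ∀ {T} {l r : Term T} → R (l ⟶ r) → (θ : FSub []) →
                   Spine withSymbols (l [ θ ]) → Computable (r [ θ ]))
      where

      Spine-↦ : ∀ {T U} {s s′ : Term (T ⇒ U)} → Spine withSymbols s → s ↦ s′ → Spine withSymbols s′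
      Spine-↦ s                 (rew ρ θ)   = ⊥-elim (rules-at-base ρ)
      Spine-↦ (head ())         (beta t u)
      Spine-↦ (app s _)         (beta t u)  = ⊥-elim (Spine-¬lam s)
      Spine-↦ (head ())         (ξ-lam st)
      Spine-↦ (head ())         (ξ-appl st)
      Spine-↦ (app s cu)        (ξ-appl st) = app (Spine-↦ s st) cu
      Spine-↦ (head ())         (ξ-appr st)
      Spine-↦ (app s cu)        (ξ-appr st) = app s (computable-↦ cu st)

      Head⇒SN : ∀ {T} {h : Term T} → Head withSymbols h → SN h
      Head⇒SN hd = acc λ st → go hd st refl
        where
        go : ∀ {T} {h s w : Term T} → Head withSymbols h → s ↦ w → s ≡ h → SN w
        go hd (rew ρ θ) eq = computable⇒SN (root-step ρ θ (transport (Spine _) (≡-sym eq) (head hd)))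
        go () (beta t u) refl
        go () (ξ-lam st) refl
        go () (ξ-appl st) refl
        go () (ξ-appr st) refl

      app-SN : ∀ {T U} {t : Term (T ⇒ U)} {u : Term T} →
               Spine withSymbols t → Computable u → SN t → SN u → SN (app t u)
      app-SN {t = t} {u} s cu (acc sn-t) (acc sn-u) = acc λ st → go st refl
        where
        go : ∀ {v w} → v ↦ w → v ≡ app t u → SN w
        go (rew ρ θ)   eq   = computable⇒SN (root-step ρ θ (transport (Spine _) (≡-sym eq) (app s cu)))
        go (beta _ _)  refl = ⊥-elim (Spine-¬lam s)
        go (ξ-appl st) refl = app-SN (Spine-↦ s st) cu (sn-t st) (acc sn-u)
        go (ξ-appr st) refl = app-SN s (computable-↦ cu st) (acc sn-t) (sn-u st)

      Spine⇒SN : ∀ {T} {t : Term T} → Spine withSymbols t → SN t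
      Spine⇒SN (head hd)  = Head⇒SN hd
      Spine⇒SN (app s cu) = app-SN s cu (Spine⇒SN s) (computable⇒SN cu)

      Spine⇒computable : ∀ {T} {t : Term T} → Spine withSymbols t → Computable t
      Spine⇒computable {base b} s = Spine⇒SN s
      Spine⇒computable {T ⇒ U}  s = Spine⇒SN s , λ u cu → Spine⇒computable (app s cu)

    module _ (CC : Closure) (rules-in-closure : ∀ ρ → R ρ → RuleInClosure CC ρ) where

      rules-at-base : ∀ {T U} {l r : Term (T ⇒ U)} → ¬ R (l ⟶ r)
      rules-at-base ρ with rules-in-closure _ ρ
      ... | ()

      module _ (isRewriteSystem : IsRewriteSystem R) where

        var-computable : ∀ x → Computable (var x)
        var-computable x = Spine⇒computable (head (var x))
          where
          no-root-step : ∀ {T} {l r : Term T} → R (l ⟶ r) → (θ : FSub []) →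
                         Spine false (l [ θ ]) → Computable (r [ θ ])
          no-root-step ρ θ s =
            ⊥-elim (Spine-¬HeadSymbol s (HeadSymbol-subst θ noBound (proj₁ (isRewriteSystem _ ρ))))
          open SpineComputability false rules-at-base no-root-step

        restrict-computableOutside : ∀ {T} (θ : FSub []) (ls : Args T) → ComputableOutside (restrict θ ls) ls
        restrict-computableOutside θ ls x ¬p =
          transport Computable (≡-sym (restrict-outside θ ls x ¬p)) (var-computable x)

        rule-root-step : IsComputabilityClosure R CC →
                         ∀ {T} {l r : Term T} → R (l ⟶ r) → (θ : FSub []) →
                         Spine true (l [ θ ]) → Computable (r [ θ ])
        rule-root-step isCC ρ θ s with rules-in-closure _ ρ | proj₂ (isRewriteSystem _ ρ)
        ... | inCC f ls r r∈CC | FV-r⊆FV-l =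
          transport Computable (subst-cong noBound r θ′≡θ-on-r)
            (isCC f ls _ r r∈CC θ′ (transport AllComputable ([]*-cong ls θ≡θ′-on-ls) args-computable)
                  (restrict-computableOutside θ ls))
          where
          θ′ : FSub []
          θ′ = restrict θ ls
          args-computable : AllComputable (ls [ θ ]*)
          args-computable = proj₂ (Spine-app* (ls [ θ ]*) (transport (Spine true) (app*-[] (sym f) ls θ) s))
          θ≡θ′-on-ls : ∀ x → x ∈FV* ls → θ x ≡ θ′ x
          θ≡θ′-on-ls x p = ≡-sym (restrict-inside θ ls x p)
          θ′≡θ-on-r : ∀ x → x ∈FV r → θ′ x ≡ θ x
          θ′≡θ-on-r x p with ∈FV-app* (sym f) ls (FV-r⊆FV-l x p)
          ... | inj₂ q = restrict-inside θ ls x q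

lemma3 : (S : Signature) → let open Syntax S in
    (R : Rule → Set) → IsRewriteSystem R →
    (CC : Closure) → IsComputabilityClosure R CC →
    (∀ ρ → R ρ → RuleInClosure CC ρ) →
    ∀ (f : Fun) → Rewriting.ComputableSymbol R f
lemma3 S R isRewriteSystem CC isCC rules-in-closure f = Spine⇒computable (head (sym f))
  where
  open SpineComputability R true (rules-at-base R CC rules-in-closure)
         (rule-root-step R CC rules-in-closure isRewriteSystem isCC)
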